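{- Let $n\ge3$ and let $S=\langle M_1,\dots,M_r\rangle\subseteq{\rm H}(n,\mathbb{Q})$ be a finitely generated matrix semigroup, with $\psi(M_i)=(\mathbf a_i,\mathbf b_i,c_i)$ for $1\le i\le r$. Then the identity matrix belongs to $S$ if there exists a product $M_{i_1}M_{i_2}\cdots M_{i_k}$, with $i_j\in[1,r]$ for all $1\le j\le k$, such that (i) $\psi(M_{i_1}M_{i_2}\cdots M_{i_k})=(\mathbf 0,\mathbf 0,c)$ for some $c\in\mathbb{Q}$, and (ii) $\mathbf a_{i_{j_1}}\cdot\mathbf b_{i_{j_2}}\neq\mathbf a_{i_{j_2}}\cdot\mathbf b_{i_{j_1}}$ for some $j_1,j_2\in[1,k]$.
   Context: ${\rm H}(n,\mathbb{Q})$ is the group of $n\times n$ matrices $\begin{pmatrix}1&\mathbf a^{\mathsf T}&c\\0&I_{n-2}&\mathbf b\\0&0&1\end{pmatrix}$ with $\mathbf a,\mathbf b\in\mathbb{Q}^{n-2}$, $c\in\mathbb{Q}$; for such $M$, $\psi(M)=(\mathbf a,\mathbf b,c)$. $\cdot$ is the dot product. $\langle M_1,\dots,M_r\rangle$ is the semigroup of all finite nonempty products of the generators. -}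

module Defs where

open import Data.Nat using (ℕ; zero; suc)
open import Data.Fin using (Fin; zero; suc; _≟_)
open import Data.Rational using (ℚ; 0ℚ; 1ℚ; _+_; _*_)
open import Data.List using (List; []; _∷_; length; lookup)
open import Data.List.NonEmpty using (List⁺; _∷_; toList)
open import Data.Sum using (_⊎_; inj₁; inj₂)
open import Data.Unit using (⊤; tt)
open import Relation.Nullary using (yes; no)
open import Relation.Binary.PropositionalEquality using (_≡_)

Mat : ℕ → Set
Mat n = Fin n → Fin n → ℚ

sumᶠ : ∀ {n} → (Fin n → ℚ) → ℚ
sumᶠ {zero} f = 0ℚ
sumᶠ {suc n} f = f zero + sumᶠ (λ i → f (suc i))

_·_ : ∀ {m} → (Fin m → ℚ) → (Fin m → ℚ) → ℚ
u · v = sumᶠ (λ i → u i * v i)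

_⊗_ : ∀ {n} → Mat n → Mat n → Mat n
(A ⊗ B) i j = sumᶠ (λ l → A i l * B l j)

idM : ∀ {n} → Mat n
idM i j with i ≟ j
... | yes _ = 1ℚ
... | no  _ = 0ℚ

_≈M_ : ∀ {n} → Mat n → Mat n → Set
A ≈M B = ∀ i j → A i j ≡ B i j

-- Index positions of Fin (2 + m): first row/col, middle block (Fin m), last.
data Pos (m : ℕ) : Set where
  top : Pos m
  mid : Fin m → Pos m
  bot : Pos m

inner : ∀ {m} → Fin (suc m) → Fin m ⊎ ⊤
inner {zero}  zero    = inj₂ tt
inner {suc m} zero    = inj₁ zero
inner {suc m} (suc i) with inner i
... | inj₁ x = inj₁ (suc x)
... | inj₂ t = inj₂ t

pos : ∀ {m} → Fin (suc (suc m)) → Pos m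
pos zero = top
pos (suc i) with inner i
... | inj₁ x = mid x
... | inj₂ _ = bot

-- The element of H(m+2, ℚ) with ψ = (a, b, c):
--   [ 1  aᵀ  c ]
--   [ 0  I   b ]
--   [ 0  0   1 ]
heis : ∀ {m} → (Fin m → ℚ) → (Fin m → ℚ) → ℚ → Mat (suc (suc m))
heis {m} a b c i j = entry (pos i) (pos j)
  where
  entry : Pos m → Pos m → ℚ
  entry top     top      = 1ℚ
  entry top     (mid y)  = a y
  entry top     bot      = c
  entry (mid x) (mid y) with x ≟ y
  ... | yes _ = 1ℚ
  ... | no  _ = 0ℚ
  entry (mid x) bot      = b x
  entry bot     bot      = 1ℚ
  entry _       _        = 0ℚ

ψa : ∀ {m} → Mat (suc (suc m)) → Fin m → ℚ
ψa M y = M zero (Data.Fin.suc (Data.Fin.inject₁ y))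

ψb : ∀ {m} → Mat (suc (suc m)) → Fin m → ℚ
ψb M x = M (Data.Fin.suc (Data.Fin.inject₁ x)) (Data.Fin.fromℕ _)

ψc : ∀ {m} → Mat (suc (suc m)) → ℚ
ψc M = M zero (Data.Fin.fromℕ _)

record Triple (m : ℕ) : Set where
  constructor ⟨_,_,_⟩
  field
    a : Fin m → ℚ
    b : Fin m → ℚ
    c : ℚ

genMat : ∀ {m} → Triple m → Mat (suc (suc m))
genMat t = heis (Triple.a t) (Triple.b t) (Triple.c t)

-- product of a list of matrices (empty product = identity, used only in tails)
prodL : ∀ {n} → List (Mat n) → Mat n
prodL []       = idM
prodL (M ∷ Ms) = M ⊗ prodL Ms

prodW : ∀ {m r} → (Fin r → Triple m) → List⁺ (Fin r) → Mat (suc (suc m))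
prodW g (i ∷ is) = genMat (g i) ⊗ prodL (Data.List.map (λ j → genMat (g j)) is)

_∈S_ : ∀ {m r} → Mat (suc (suc m)) → (Fin r → Triple m) → Set
M ∈S g = Data.Product.Σ (List⁺ _) (λ w → prodW g w ≈M M)
  where import Data.Product

letter : ∀ {r} (w : List⁺ (Fin r)) → Fin (length (toList w)) → Fin r
letter w j = lookup (toList w) j

-- Writing ψ(M) = (a, b, c), the product in H(n, ℚ) is (a, b, c)(a′, b′, c′) = (a + a′, b + b′, c + c′ + a·b′),
-- so an element with a = b = 0 is central, and xy = yx · (0, 0, ω(x, y)) with ω(x, y) = a_x·b_y − a_y·b_x.
-- If the word W = M_{i_1} ⋯ M_{i_k} is central with value c, so is every cyclic rotation of it; in particular
-- P U and Q V are central with value c, where P, Q are the letters j₁, j₂ of (ii) and U, V the rest of the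
-- rotated words. Then X_k = P^k Q^k U^k V^k and X′_k = Q^k P^k V^k U^k are central with values
-- 2kc + k²ω and 2kc − k²ω, where ω = ω(P, Q) ≠ 0. Writing c/ω · (N + 1) = α − β with naturals N, α, β
-- (clear the denominator) and taking k = 2(α + β + 2), the product X_k^{β+1} X′_k^{α+1} W^{k²N} has value 0,
-- i.e. it is the identity matrix.

module Submission where

open import Defs
open import Data.Empty using (⊥-elim)
open import Data.Fin as Fin using (Fin; zero; suc; inject₁)
open import Data.Integer as ℤ using (ℤ; -[1+_])
import Data.Integer.Properties as ℤ
open import Data.Integer.Solver renaming (module +-*-Solver to ℤ-Solver)
open import Data.List using (List; []; _∷_; _++_; map; concat; replicate; lookup)
open import Data.List.Membership.Propositional.Properties using (∈-∃++; ∈-lookup)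
open import Data.List.NonEmpty using (List⁺; _∷_; toList)
open import Data.Nat as ℕ using (ℕ; zero; suc; _≤_)
open import Data.Product using (Σ; ∃-syntax; _×_; _,_)
open import Data.Rational using (ℚ; 0ℚ; 1ℚ; _+_; _*_; -_; _-_; 1/_; mkℚ; toℚᵘ; ≢-nonZero)
open import Data.Rational.Properties
  using ( +-0-group; +-assoc; +-comm; +-identityˡ; +-identityʳ; *-assoc; *-comm; *-identityˡ; *-identityʳ
        ; *-zeroˡ; *-zeroʳ; *-distribˡ-+; *-inverseˡ
        ; toℚᵘ-injective; toℚᵘ-homo-+; toℚᵘ-homo-*; toℚᵘ-homo‿- )
open import Algebra.Properties.Group +-0-group using (inverseʳ-unique; x∙y⁻¹≈ε⇒x≈y)
open import Data.Rational.Solver renaming (module +-*-Solver to ℚ-Solver)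
open import Data.Rational.Unnormalised as ℚᵘ using (mkℚᵘ; *≡*) renaming (_≃_ to _≃ᵘ_)
import Data.Rational.Unnormalised.Properties as ℚᵘ
open import Data.Sum using (_⊎_; inj₁; inj₂; [_,_]′)
open import Data.Unit using (⊤; tt)
open import Relation.Binary.Bundles using (Setoid)
open import Relation.Binary.PropositionalEquality
import Relation.Binary.Reasoning.Setoid
open import Relation.Nullary using (yes; no)

fromℕ : ℕ → ℚ
fromℕ zero    = 0ℚ
fromℕ (suc n) = 1ℚ + fromℕ n

toℚᵘ-fromℕ : ∀ k → toℚᵘ (fromℕ k) ≃ᵘ mkℚᵘ (ℤ.+ k) 0
toℚᵘ-fromℕ zero    = ℚᵘ.≃-refl
toℚᵘ-fromℕ (suc k) = begin
  toℚᵘ (1ℚ + fromℕ k)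
    ≈⟨ toℚᵘ-homo-+ 1ℚ (fromℕ k) ⟩
  toℚᵘ 1ℚ ℚᵘ.+ toℚᵘ (fromℕ k)
    ≈⟨ ℚᵘ.+-congʳ (toℚᵘ 1ℚ) (toℚᵘ-fromℕ k) ⟩
  mkℚᵘ (ℤ.+ 1) 0 ℚᵘ.+ mkℚᵘ (ℤ.+ k) 0
    ≈⟨ *≡* (solve 1 (λ k → (con (ℤ.+ 1) :* con (ℤ.+ 1) :+ k :* con (ℤ.+ 1)) :* con (ℤ.+ 1)
                          := (con (ℤ.+ 1) :+ k) :* (con (ℤ.+ 1) :* con (ℤ.+ 1))) refl (ℤ.+ k)) ⟩
  mkℚᵘ (ℤ.+ suc k) 0 ∎
  where
  open ℚᵘ.≃-Reasoning
  open ℤ-Solver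

toℚᵘ-fromℕ-difference : ∀ α β → toℚᵘ (fromℕ α - fromℕ β) ≃ᵘ mkℚᵘ (ℤ.+ α ℤ.- ℤ.+ β) 0
toℚᵘ-fromℕ-difference α β = begin
  toℚᵘ (fromℕ α - fromℕ β)
    ≈⟨ toℚᵘ-homo-+ (fromℕ α) (- fromℕ β) ⟩
  toℚᵘ (fromℕ α) ℚᵘ.+ toℚᵘ (- fromℕ β)
    ≈⟨ ℚᵘ.+-cong (toℚᵘ-fromℕ α) (ℚᵘ.≃-trans (toℚᵘ-homo‿- (fromℕ β)) (ℚᵘ.-‿cong (toℚᵘ-fromℕ β))) ⟩
  mkℚᵘ (ℤ.+ α) 0 ℚᵘ.- mkℚᵘ (ℤ.+ β) 0
    ≈⟨ *≡* (solve 2 (λ a b → (a :* con (ℤ.+ 1) :+ (:- b) :* con (ℤ.+ 1)) :* con (ℤ.+ 1)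
                            := (a :- b) :* (con (ℤ.+ 1) :* con (ℤ.+ 1))) refl (ℤ.+ α) (ℤ.+ β)) ⟩
  mkℚᵘ (ℤ.+ α ℤ.- ℤ.+ β) 0 ∎
  where
  open ℚᵘ.≃-Reasoning
  open ℤ-Solver

ℤ-difference : ∀ (i : ℤ) → ∃[ α ] ∃[ β ] ℤ.+ α ℤ.- ℤ.+ β ≡ i
ℤ-difference (ℤ.+ α)  = α , 0 , ℤ.+-identityʳ (ℤ.+ α)
ℤ-difference -[1+ t ] = 0 , suc t , refl

clear-denominator : ∀ ρ → ∃[ N ] ∃[ α ] ∃[ β ] ρ * fromℕ (suc N) ≡ fromℕ α - fromℕ β
clear-denominator ρ@(mkℚ n d _) with ℤ-difference n
... | α , β , α-β≡n = d , α , β , toℚᵘ-injective (begin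
  toℚᵘ (ρ * fromℕ (suc d))
    ≈⟨ toℚᵘ-homo-* ρ (fromℕ (suc d)) ⟩
  mkℚᵘ n d ℚᵘ.* toℚᵘ (fromℕ (suc d))
    ≈⟨ ℚᵘ.*-congˡ {mkℚᵘ n d} (toℚᵘ-fromℕ (suc d)) ⟩
  mkℚᵘ n d ℚᵘ.* mkℚᵘ (ℤ.+ suc d) 0
    ≈⟨ *≡* (solve 2 (λ n e → (n :* e) :* con (ℤ.+ 1) := n :* (e :* con (ℤ.+ 1))) refl n (ℤ.+ suc d)) ⟩
  mkℚᵘ n 0
    ≈⟨ ℚᵘ.≃-reflexive (cong (λ i → mkℚᵘ i 0) α-β≡n) ⟨
  mkℚᵘ (ℤ.+ α ℤ.- ℤ.+ β) 0
    ≈⟨ toℚᵘ-fromℕ-difference α β ⟨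
  toℚᵘ (fromℕ α - fromℕ β) ∎)
  where
  open ℚᵘ.≃-Reasoning
  open ℤ-Solver

open ℚ-Solver

fromℕ-suc-* : ∀ k v → fromℕ (suc k) * v ≡ v + fromℕ k * v
fromℕ-suc-* k v = solve 2 (λ n v → (con 1ℚ :+ n) :* v := v :+ n :* v) refl (fromℕ k) v

fromℕ-+ : ∀ m n → fromℕ (m ℕ.+ n) ≡ fromℕ m + fromℕ n
fromℕ-+ zero    n = sym (+-identityˡ (fromℕ n))
fromℕ-+ (suc m) n = trans (cong (1ℚ +_) (fromℕ-+ m n)) (sym (+-assoc 1ℚ (fromℕ m) (fromℕ n)))

fromℕ-* : ∀ m n → fromℕ (m ℕ.* n) ≡ fromℕ m * fromℕ n
fromℕ-* zero    n = sym (*-zeroˡ (fromℕ n))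
fromℕ-* (suc m) n = begin
  fromℕ (n ℕ.+ m ℕ.* n)         ≡⟨ fromℕ-+ n (m ℕ.* n) ⟩
  fromℕ n + fromℕ (m ℕ.* n)     ≡⟨ cong (fromℕ n +_) (fromℕ-* m n) ⟩
  fromℕ n + fromℕ m * fromℕ n   ≡⟨ solve 2 (λ x y → y :+ x :* y := (con 1ℚ :+ x) :* y) refl (fromℕ m) (fromℕ n) ⟩
  (1ℚ + fromℕ m) * fromℕ n      ∎
  where open ≡-Reasoning

sumᶠ-cong : ∀ {n} {f g : Fin n → ℚ} → (∀ i → f i ≡ g i) → sumᶠ f ≡ sumᶠ g
sumᶠ-cong {zero}  f≡g = refl
sumᶠ-cong {suc n} f≡g = cong₂ _+_ (f≡g zero) (sumᶠ-cong (λ i → f≡g (suc i)))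

sumᶠ-zero : ∀ {n} {f : Fin n → ℚ} → (∀ i → f i ≡ 0ℚ) → sumᶠ f ≡ 0ℚ
sumᶠ-zero {zero}  f≡0 = refl
sumᶠ-zero {suc n} f≡0 = cong₂ _+_ (f≡0 zero) (sumᶠ-zero (λ i → f≡0 (suc i)))

sumᶠ-+ : ∀ {n} (f g : Fin n → ℚ) → sumᶠ (λ i → f i + g i) ≡ sumᶠ f + sumᶠ g
sumᶠ-+ {zero}  f g = refl
sumᶠ-+ {suc n} f g = begin
  (f zero + g zero) + sumᶠ (λ i → f (suc i) + g (suc i))
    ≡⟨ cong (f zero + g zero +_) (sumᶠ-+ (λ i → f (suc i)) (λ i → g (suc i))) ⟩
  (f zero + g zero) + (F + G)
    ≡⟨ solve 4 (λ a b c d → (a :+ b) :+ (c :+ d) := (a :+ c) :+ (b :+ d)) refl (f zero) (g zero) F G ⟩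
  (f zero + F) + (g zero + G) ∎
  where
  open ≡-Reasoning
  F = sumᶠ (λ i → f (suc i))
  G = sumᶠ (λ i → g (suc i))

sumᶠ-*ˡ : ∀ {n} (s : ℚ) (f : Fin n → ℚ) → sumᶠ (λ i → s * f i) ≡ s * sumᶠ f
sumᶠ-*ˡ {zero}  s f = sym (*-zeroʳ s)
sumᶠ-*ˡ {suc n} s f =
  trans (cong (s * f zero +_) (sumᶠ-*ˡ s (λ i → f (suc i))))
        (sym (*-distribˡ-+ s (f zero) (sumᶠ (λ i → f (suc i)))))

δ : ∀ {m} → Fin m → Fin m → ℚ
δ zero    zero    = 1ℚ
δ zero    (suc _) = 0ℚ
δ (suc _) zero    = 0ℚ
δ (suc x) (suc y) = δ x y

δ-refl : ∀ {m} (x : Fin m) → δ x x ≡ 1ℚ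
δ-refl zero    = refl
δ-refl (suc x) = δ-refl x

δ-≢ : ∀ {m} {x y : Fin m} → x ≢ y → δ x y ≡ 0ℚ
δ-≢ {x = zero}  {zero}  x≢y = ⊥-elim (x≢y refl)
δ-≢ {x = zero}  {suc y} x≢y = refl
δ-≢ {x = suc x} {zero}  x≢y = refl
δ-≢ {x = suc x} {suc y} x≢y = δ-≢ (λ x≡y → x≢y (cong suc x≡y))

δ-sym : ∀ {m} (x y : Fin m) → δ x y ≡ δ y x
δ-sym zero    zero    = refl
δ-sym zero    (suc y) = refl
δ-sym (suc x) zero    = refl
δ-sym (suc x) (suc y) = δ-sym x y

sumᶠ-δˡ : ∀ {m} (x : Fin m) (f : Fin m → ℚ) → sumᶠ (λ y → δ x y * f y) ≡ f x
sumᶠ-δˡ zero f = begin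
  1ℚ * f zero + sumᶠ (λ y → 0ℚ * f (suc y))
    ≡⟨ cong (1ℚ * f zero +_) (sumᶠ-zero (λ y → *-zeroˡ (f (suc y)))) ⟩
  1ℚ * f zero + 0ℚ  ≡⟨ +-identityʳ _ ⟩
  1ℚ * f zero       ≡⟨ *-identityˡ _ ⟩
  f zero            ∎
  where open ≡-Reasoning
sumᶠ-δˡ (suc x) f = begin
  0ℚ * f zero + sumᶠ (λ y → δ x y * f (suc y))
    ≡⟨ cong₂ _+_ (*-zeroˡ (f zero)) (sumᶠ-δˡ x (λ y → f (suc y))) ⟩
  0ℚ + f (suc x)  ≡⟨ +-identityˡ _ ⟩
  f (suc x)       ∎
  where open ≡-Reasoning

sumᶠ-δʳ : ∀ {m} (x : Fin m) (f : Fin m → ℚ) → sumᶠ (λ y → f y * δ y x) ≡ f x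
sumᶠ-δʳ x f =
  trans (sumᶠ-cong (λ y → trans (*-comm (f y) (δ y x)) (cong (_* f y) (δ-sym y x))))
        (sumᶠ-δˡ x f)

·-cong : ∀ {m} {u u′ v v′ : Fin m → ℚ} →
  (∀ i → u i ≡ u′ i) → (∀ i → v i ≡ v′ i) → u · v ≡ u′ · v′
·-cong u≡u′ v≡v′ = sumᶠ-cong (λ i → cong₂ _*_ (u≡u′ i) (v≡v′ i))

·-zeroˡ : ∀ {m} (v : Fin m → ℚ) → (λ _ → 0ℚ) · v ≡ 0ℚ
·-zeroˡ v = sumᶠ-zero (λ i → *-zeroˡ (v i))

·-zeroʳ : ∀ {m} (u : Fin m → ℚ) → u · (λ _ → 0ℚ) ≡ 0ℚ
·-zeroʳ u = sumᶠ-zero (λ i → *-zeroʳ (u i))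

·-distribʳ-+ : ∀ {m} (u v w : Fin m → ℚ) → (λ i → u i + v i) · w ≡ u · w + v · w
·-distribʳ-+ u v w =
  trans (sumᶠ-cong (λ i → solve 3 (λ x y z → (x :+ y) :* z := x :* z :+ y :* z) refl (u i) (v i) (w i)))
        (sumᶠ-+ (λ i → u i * w i) (λ i → v i * w i))

·-distribˡ-+ : ∀ {m} (u v w : Fin m → ℚ) → u · (λ i → v i + w i) ≡ u · v + u · w
·-distribˡ-+ u v w =
  trans (sumᶠ-cong (λ i → *-distribˡ-+ (u i) (v i) (w i)))
        (sumᶠ-+ (λ i → u i * v i) (λ i → u i * w i))

·-scale : ∀ {m} (s t : ℚ) (u v : Fin m → ℚ) → (λ i → s * u i) · (λ i → t * v i) ≡ s * t * (u · v)
·-scale s t u v =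
  trans (sumᶠ-cong (λ i → solve 4 (λ s t x y → (s :* x) :* (t :* y) := (s :* t) :* (x :* y)) refl s t (u i) (v i)))
        (sumᶠ-*ˡ (s * t) (λ i → u i * v i))

-- The group law on triples

open Triple

infixl 7 _∙_
_∙_ : ∀ {m} → Triple m → Triple m → Triple m
x ∙ y = ⟨ (λ i → a x i + a y i) , (λ i → b x i + b y i) , c x + c y + a x · b y ⟩

central : ∀ {m} → ℚ → Triple m
central u = ⟨ (λ _ → 0ℚ) , (λ _ → 0ℚ) , u ⟩

ε : ∀ {m} → Triple m
ε = central 0ℚ

ω : ∀ {m} → Triple m → Triple m → ℚ
ω x y = a x · b y - a y · b x

infix 4 _≈_
_≈_ : ∀ {m} → Triple m → Triple m → Set
x ≈ y = (∀ i → a x i ≡ a y i) × (∀ i → b x i ≡ b y i) × c x ≡ c y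

module _ {m : ℕ} where

  ≈-refl : {x : Triple m} → x ≈ x
  ≈-refl = (λ _ → refl) , (λ _ → refl) , refl

  ≈-sym : {x y : Triple m} → x ≈ y → y ≈ x
  ≈-sym (p , q , r) = (λ i → sym (p i)) , (λ i → sym (q i)) , sym r

  ≈-trans : {x y z : Triple m} → x ≈ y → y ≈ z → x ≈ z
  ≈-trans (p , q , r) (p′ , q′ , r′) = (λ i → trans (p i) (p′ i)) , (λ i → trans (q i) (q′ i)) , trans r r′

  ≈-setoid : Setoid _ _
  ≈-setoid = record
    { Carrier = Triple m ; _≈_ = _≈_
    ; isEquivalence = record { refl = ≈-refl ; sym = ≈-sym ; trans = ≈-trans } }

  ∙-cong : {x x′ y y′ : Triple m} → x ≈ x′ → y ≈ y′ → x ∙ y ≈ x′ ∙ y′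
  ∙-cong (p , q , r) (p′ , q′ , r′) =
    (λ i → cong₂ _+_ (p i) (p′ i)) , (λ i → cong₂ _+_ (q i) (q′ i)) ,
    cong₂ _+_ (cong₂ _+_ r r′) (·-cong p q′)

  ∙-congˡ : (x : Triple m) {y y′ : Triple m} → y ≈ y′ → x ∙ y ≈ x ∙ y′
  ∙-congˡ x = ∙-cong (≈-refl {x})

  ∙-congʳ : (y : Triple m) {x x′ : Triple m} → x ≈ x′ → x ∙ y ≈ x′ ∙ y
  ∙-congʳ y x≈x′ = ∙-cong x≈x′ ≈-refl

  central-cong : {u v : ℚ} → u ≡ v → central {m} u ≈ central v
  central-cong u≡v = (λ _ → refl) , (λ _ → refl) , u≡v

  ∙-assoc : (x y z : Triple m) → (x ∙ y) ∙ z ≈ x ∙ (y ∙ z)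
  ∙-assoc x y z = (λ i → +-assoc (a x i) (a y i) (a z i)) , (λ i → +-assoc (b x i) (b y i) (b z i)) , c-assoc
    where
    open ≡-Reasoning
    c-assoc : c x + c y + a x · b y + c z + (λ i → a x i + a y i) · b z
            ≡ c x + (c y + c z + a y · b z) + a x · (λ i → b y i + b z i)
    c-assoc = begin
      c x + c y + a x · b y + c z + (λ i → a x i + a y i) · b z
        ≡⟨ cong (c x + c y + a x · b y + c z +_) (·-distribʳ-+ (a x) (a y) (b z)) ⟩
      c x + c y + a x · b y + c z + (a x · b z + a y · b z)
        ≡⟨ solve 6 (λ p q r s t u → p :+ q :+ s :+ r :+ (t :+ u) := p :+ (q :+ r :+ u) :+ (s :+ t)) refl
             (c x) (c y) (c z) (a x · b y) (a x · b z) (a y · b z) ⟩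
      c x + (c y + c z + a y · b z) + (a x · b y + a x · b z)
        ≡⟨ cong (c x + (c y + c z + a y · b z) +_) (·-distribˡ-+ (a x) (b y) (b z)) ⟨
      c x + (c y + c z + a y · b z) + a x · (λ i → b y i + b z i) ∎

  ∙-identityˡ : (x : Triple m) → ε ∙ x ≈ x
  ∙-identityˡ x = (λ i → +-identityˡ (a x i)) , (λ i → +-identityˡ (b x i)) ,
    trans (cong (0ℚ + c x +_) (·-zeroˡ (b x))) (solve 1 (λ p → con 0ℚ :+ p :+ con 0ℚ := p) refl (c x))

  ∙-identityʳ : (x : Triple m) → x ∙ ε ≈ x
  ∙-identityʳ x = (λ i → +-identityʳ (a x i)) , (λ i → +-identityʳ (b x i)) ,
    trans (cong (c x + 0ℚ +_) (·-zeroʳ (a x))) (solve 1 (λ p → p :+ con 0ℚ :+ con 0ℚ := p) refl (c x))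

  central-∙ : (u v : ℚ) → central u ∙ central v ≈ central {m} (u + v)
  central-∙ u v = (λ _ → +-identityʳ 0ℚ) , (λ _ → +-identityʳ 0ℚ) ,
    trans (cong (u + v +_) (·-zeroˡ {m} (λ _ → 0ℚ))) (+-identityʳ (u + v))

  central-comm : (u : ℚ) (x : Triple m) → central u ∙ x ≈ x ∙ central u
  central-comm u x = (λ i → +-comm 0ℚ (a x i)) , (λ i → +-comm 0ℚ (b x i)) , (begin
    u + c x + (λ _ → 0ℚ) · b x  ≡⟨ cong₂ _+_ (+-comm u (c x)) (·-zeroˡ (b x)) ⟩
    c x + u + 0ℚ                ≡⟨ cong (c x + u +_) (·-zeroʳ (a x)) ⟨
    c x + u + a x · (λ _ → 0ℚ)  ∎)
    where open ≡-Reasoning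

  ∙-commutator : (x y : Triple m) → x ∙ y ≈ (y ∙ x) ∙ central (ω x y)
  ∙-commutator x y =
    (λ i → trans (+-comm (a x i) (a y i)) (sym (+-identityʳ _))) ,
    (λ i → trans (+-comm (b x i) (b y i)) (sym (+-identityʳ _))) ,
    trans (solve 4 (λ p q r s → p :+ q :+ r := q :+ p :+ s :+ (r :- s) :+ con 0ℚ) refl (c x) (c y) (a x · b y) (a y · b x))
          (cong (c y + c x + a y · b x + (a x · b y - a y · b x) +_) (sym (·-zeroʳ (λ i → a y i + a x i))))

  ∙-rotate-central : (x y : Triple m) (u : ℚ) → x ∙ y ≈ central u → y ∙ x ≈ central u
  ∙-rotate-central x y u (a≡0 , b≡0 , c≡u) =
    (λ i → trans (+-comm (a y i) (a x i)) (a≡0 i)) ,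
    (λ i → trans (+-comm (b y i) (b x i)) (b≡0 i)) ,
    trans (cong₂ _+_ (+-comm (c y) (c x)) cross-symmetric) c≡u
    where
    cross-symmetric : a y · b x ≡ a x · b y
    cross-symmetric = sumᶠ-cong λ i → begin
      a y i * b x i      ≡⟨ cong (_* b x i) (inverseʳ-unique (a x i) (a y i) (a≡0 i)) ⟩
      (- a x i) * b x i  ≡⟨ solve 2 (λ s t → (:- s) :* t := s :* (:- t)) refl (a x i) (b x i) ⟩
      a x i * (- b x i)  ≡⟨ cong (a x i *_) (inverseʳ-unique (b x i) (b y i) (b≡0 i)) ⟨
      a x i * b y i      ∎
      where open ≡-Reasoning

module ≈-Reasoning {m : ℕ} = Relation.Binary.Reasoning.Setoid (≈-setoid {m})

ω-cong : ∀ {m} {x x′ y y′ : Triple m} → x ≈ x′ → y ≈ y′ → ω x y ≡ ω x′ y′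
ω-cong (ax , bx , _) (ay , by , _) = cong₂ _-_ (·-cong ax by) (·-cong ay bx)

ω-antisym : ∀ {m} (x y : Triple m) → ω y x ≡ - ω x y
ω-antisym x y = solve 2 (λ p q → q :- p := :- (p :- q)) refl (a x · b y) (a y · b x)

module _ {m : ℕ} where

  commutator-central : (x y x′ y′ : Triple m) (s t : ℚ) → x ∙ x′ ≈ central s → y ∙ y′ ≈ central t →
    x ∙ (y ∙ (x′ ∙ y′)) ≈ central (s + t + ω x y)
  commutator-central x y x′ y′ s t xx′≈s yy′≈t = begin
    x ∙ (y ∙ (x′ ∙ y′))            ≈⟨ ∙-assoc x y (x′ ∙ y′) ⟨
    (x ∙ y) ∙ (x′ ∙ y′)            ≈⟨ ∙-congʳ (x′ ∙ y′) (∙-commutator x y) ⟩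
    ((y ∙ x) ∙ κ) ∙ (x′ ∙ y′)      ≈⟨ ∙-assoc (y ∙ x) κ (x′ ∙ y′) ⟩
    (y ∙ x) ∙ (κ ∙ (x′ ∙ y′))      ≈⟨ ∙-congˡ (y ∙ x) (central-comm (ω x y) (x′ ∙ y′)) ⟩
    (y ∙ x) ∙ ((x′ ∙ y′) ∙ κ)      ≈⟨ ∙-assoc (y ∙ x) (x′ ∙ y′) κ ⟨
    ((y ∙ x) ∙ (x′ ∙ y′)) ∙ κ      ≈⟨ ∙-congʳ κ (∙-assoc y x (x′ ∙ y′)) ⟩
    (y ∙ (x ∙ (x′ ∙ y′))) ∙ κ      ≈⟨ ∙-congʳ κ (∙-congˡ y (∙-assoc x x′ y′)) ⟨
    (y ∙ ((x ∙ x′) ∙ y′)) ∙ κ      ≈⟨ ∙-congʳ κ (∙-congˡ y (∙-congʳ y′ xx′≈s)) ⟩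
    (y ∙ (central s ∙ y′)) ∙ κ     ≈⟨ ∙-congʳ κ (∙-congˡ y (central-comm s y′)) ⟩
    (y ∙ (y′ ∙ central s)) ∙ κ     ≈⟨ ∙-congʳ κ (∙-assoc y y′ (central s)) ⟨
    ((y ∙ y′) ∙ central s) ∙ κ     ≈⟨ ∙-congʳ κ (∙-congʳ (central s) yy′≈t) ⟩
    (central t ∙ central s) ∙ κ    ≈⟨ ∙-congʳ κ (central-∙ t s) ⟩
    central (t + s) ∙ κ            ≈⟨ central-∙ (t + s) (ω x y) ⟩
    central (t + s + ω x y)        ≈⟨ central-cong (cong (_+ ω x y) (+-comm t s)) ⟩
    central (s + t + ω x y)        ∎
    where
    open ≈-Reasoning
    κ = central (ω x y)

interleavedCentre : ℕ → ℚ → ℚ → ℚ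
interleavedCentre k u w = fromℕ k * u + fromℕ k * u + fromℕ k * fromℕ k * w

module _ {m : ℕ} where

  infixr 8 _^_
  _^_ : Triple m → ℕ → Triple m
  x ^ zero  = ε
  x ^ suc k = x ∙ x ^ k

  ^-cong : {x y : Triple m} → x ≈ y → ∀ k → x ^ k ≈ y ^ k
  ^-cong x≈y zero    = ≈-refl
  ^-cong x≈y (suc k) = ∙-cong x≈y (^-cong x≈y k)

  a-^ : (x : Triple m) (k : ℕ) (i : Fin m) → a (x ^ k) i ≡ fromℕ k * a x i
  a-^ x zero    i = sym (*-zeroˡ (a x i))
  a-^ x (suc k) i = trans (cong (a x i +_) (a-^ x k i)) (sym (fromℕ-suc-* k (a x i)))

  b-^ : (x : Triple m) (k : ℕ) (i : Fin m) → b (x ^ k) i ≡ fromℕ k * b x i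
  b-^ x zero    i = sym (*-zeroˡ (b x i))
  b-^ x (suc k) i = trans (cong (b x i +_) (b-^ x k i)) (sym (fromℕ-suc-* k (b x i)))

  ω-^ : (x y : Triple m) (k : ℕ) → ω (x ^ k) (y ^ k) ≡ fromℕ k * fromℕ k * ω x y
  ω-^ x y k = begin
    a (x ^ k) · b (y ^ k) - a (y ^ k) · b (x ^ k)
      ≡⟨ cong₂ _-_ (·-cong (a-^ x k) (b-^ y k)) (·-cong (a-^ y k) (b-^ x k)) ⟩
    (λ i → K * a x i) · (λ i → K * b y i) - (λ i → K * a y i) · (λ i → K * b x i)
      ≡⟨ cong₂ _-_ (·-scale K K (a x) (b y)) (·-scale K K (a y) (b x)) ⟩
    K * K * (a x · b y) - K * K * (a y · b x)
      ≡⟨ solve 3 (λ k p q → k :* p :- k :* q := k :* (p :- q)) refl (K * K) (a x · b y) (a y · b x) ⟩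
    K * K * ω x y ∎
    where
    K = fromℕ k
    open ≡-Reasoning

  central-^ : (u : ℚ) (k : ℕ) → central u ^ k ≈ central (fromℕ k * u)
  central-^ u zero    = central-cong (sym (*-zeroˡ u))
  central-^ u (suc k) = begin
    central u ∙ central u ^ k           ≈⟨ ∙-congˡ (central u) (central-^ u k) ⟩
    central u ∙ central (fromℕ k * u)  ≈⟨ central-∙ u (fromℕ k * u) ⟩
    central (u + fromℕ k * u)          ≈⟨ central-cong (fromℕ-suc-* k u) ⟨
    central (fromℕ (suc k) * u)        ∎
    where open ≈-Reasoning

  ^-comm : (x y : Triple m) → x ∙ y ≈ y ∙ x → ∀ k → x ^ k ∙ y ≈ y ∙ x ^ k
  ^-comm x y xy≈yx zero    = ≈-trans (∙-identityˡ y) (≈-sym (∙-identityʳ y))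
  ^-comm x y xy≈yx (suc k) = begin
    (x ∙ x ^ k) ∙ y  ≈⟨ ∙-assoc x (x ^ k) y ⟩
    x ∙ (x ^ k ∙ y)  ≈⟨ ∙-congˡ x (^-comm x y xy≈yx k) ⟩
    x ∙ (y ∙ x ^ k)  ≈⟨ ∙-assoc x y (x ^ k) ⟨
    (x ∙ y) ∙ x ^ k  ≈⟨ ∙-congʳ (x ^ k) xy≈yx ⟩
    (y ∙ x) ∙ x ^ k  ≈⟨ ∙-assoc y x (x ^ k) ⟩
    y ∙ (x ∙ x ^ k)  ∎
    where open ≈-Reasoning

  ^-∙-central : (x y : Triple m) (u : ℚ) → x ∙ y ≈ central u → ∀ k → x ^ k ∙ y ^ k ≈ central (fromℕ k * u)
  ^-∙-central x y u xy≈u zero    = ≈-trans (∙-identityˡ ε) (central-cong (sym (*-zeroˡ u)))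
  ^-∙-central x y u xy≈u (suc k) = begin
    (x ∙ x ^ k) ∙ (y ∙ y ^ k)      ≈⟨ ∙-assoc x (x ^ k) (y ∙ y ^ k) ⟩
    x ∙ (x ^ k ∙ (y ∙ y ^ k))      ≈⟨ ∙-congˡ x (∙-assoc (x ^ k) y (y ^ k)) ⟨
    x ∙ ((x ^ k ∙ y) ∙ y ^ k)      ≈⟨ ∙-congˡ x (∙-congʳ (y ^ k) (^-comm x y xy≈yx k)) ⟩
    x ∙ ((y ∙ x ^ k) ∙ y ^ k)      ≈⟨ ∙-congˡ x (∙-assoc y (x ^ k) (y ^ k)) ⟩
    x ∙ (y ∙ (x ^ k ∙ y ^ k))      ≈⟨ ∙-congˡ x (∙-congˡ y (^-∙-central x y u xy≈u k)) ⟩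
    x ∙ (y ∙ central (fromℕ k * u))  ≈⟨ ∙-assoc x y (central (fromℕ k * u)) ⟨
    (x ∙ y) ∙ central (fromℕ k * u)  ≈⟨ ∙-congʳ (central (fromℕ k * u)) xy≈u ⟩
    central u ∙ central (fromℕ k * u) ≈⟨ central-∙ u (fromℕ k * u) ⟩
    central (u + fromℕ k * u)        ≈⟨ central-cong (fromℕ-suc-* k u) ⟨
    central (fromℕ (suc k) * u)      ∎
    where
    open ≈-Reasoning
    xy≈yx : x ∙ y ≈ y ∙ x
    xy≈yx = ≈-trans xy≈u (≈-sym (∙-rotate-central x y u xy≈u))

  interleaved-^ : (x y x′ y′ : Triple m) (u : ℚ) → x ∙ x′ ≈ central u → y ∙ y′ ≈ central u → ∀ k →
    x ^ k ∙ (y ^ k ∙ (x′ ^ k ∙ y′ ^ k)) ≈ central (interleavedCentre k u (ω x y))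
  interleaved-^ x y x′ y′ u xx′≈u yy′≈u k =
    ≈-trans (commutator-central (x ^ k) (y ^ k) (x′ ^ k) (y′ ^ k) _ _
               (^-∙-central x x′ u xx′≈u k) (^-∙-central y y′ u yy′≈u k))
            (central-cong (cong (fromℕ k * u + fromℕ k * u +_) (ω-^ x y k)))

-- Heisenberg matrices in block coordinates

-- The entries of Defs.heis, with the Kronecker δ in place of the ≟-test on the middle block.
entry : ∀ {m} → Triple m → Pos m → Pos m → ℚ
entry t top     top     = 1ℚ
entry t top     (mid y) = a t y
entry t top     bot     = c t
entry t (mid x) (mid y) = δ x y
entry t (mid x) bot     = b t x
entry t bot     bot     = 1ℚ
entry t (mid x) top     = 0ℚ
entry t bot     top     = 0ℚ
entry t bot     (mid y) = 0ℚ

genMat-entry : ∀ {m} (t : Triple m) i j → genMat t i j ≡ entry t (pos i) (pos j)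
genMat-entry t i j with pos i | pos j
... | top   | top   = refl
... | top   | mid y = refl
... | top   | bot   = refl
... | mid x | top   = refl
... | mid x | mid y with x Fin.≟ y
...   | yes refl = sym (δ-refl x)
...   | no  x≢y  = sym (δ-≢ x≢y)
genMat-entry t i j | mid x | bot   = refl
genMat-entry t i j | bot   | top   = refl
genMat-entry t i j | bot   | mid y = refl
genMat-entry t i j | bot   | bot   = refl

entry-cong : ∀ {m} {x y : Triple m} → x ≈ y → ∀ P Q → entry x P Q ≡ entry y P Q
entry-cong (a≡ , _ , _)  top     (mid w) = a≡ w
entry-cong (_ , _ , c≡)  top     bot     = c≡
entry-cong (_ , b≡ , _)  (mid v) bot     = b≡ v
entry-cong _             top     top     = refl
entry-cong _             (mid v) top     = refl
entry-cong _             (mid v) (mid w) = refl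
entry-cong _             bot     top     = refl
entry-cong _             bot     (mid w) = refl
entry-cong _             bot     bot     = refl

sumᶠ-inner : ∀ {m} (G : Fin m ⊎ ⊤ → ℚ) →
  sumᶠ (λ i → G (inner i)) ≡ sumᶠ (λ x → G (inj₁ x)) + G (inj₂ tt)
sumᶠ-inner {zero}  G = +-comm (G (inj₂ tt)) 0ℚ
sumᶠ-inner {suc m} G = begin
  G (inj₁ zero) + sumᶠ (λ i → G (inner (suc i)))
    ≡⟨ cong (G (inj₁ zero) +_) (sumᶠ-cong inner-suc) ⟩
  G (inj₁ zero) + sumᶠ (λ i → G′ (inner i))
    ≡⟨ cong (G (inj₁ zero) +_) (sumᶠ-inner G′) ⟩
  G (inj₁ zero) + (sumᶠ (λ x → G (inj₁ (suc x))) + G (inj₂ tt))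
    ≡⟨ +-assoc (G (inj₁ zero)) _ _ ⟨
  G (inj₁ zero) + sumᶠ (λ x → G (inj₁ (suc x))) + G (inj₂ tt) ∎
  where
  open ≡-Reasoning
  G′ : Fin m ⊎ ⊤ → ℚ
  G′ = [ (λ x → G (inj₁ (suc x))) , (λ _ → G (inj₂ tt)) ]′
  inner-suc : ∀ i → G (inner (suc i)) ≡ G′ (inner i)
  inner-suc i with inner i
  ... | inj₁ x = refl
  ... | inj₂ _ = refl

sumᶠ-pos : ∀ {m} (F : Pos m → ℚ) →
  sumᶠ (λ l → F (pos l)) ≡ F top + sumᶠ (λ x → F (mid x)) + F bot
sumᶠ-pos F = begin
  F top + sumᶠ (λ i → F (pos (suc i)))  ≡⟨ cong (F top +_) (sumᶠ-cong pos-suc) ⟩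
  F top + sumᶠ (λ i → F′ (inner i))     ≡⟨ cong (F top +_) (sumᶠ-inner F′) ⟩
  F top + (sumᶠ (λ x → F (mid x)) + F bot)  ≡⟨ +-assoc (F top) _ _ ⟨
  F top + sumᶠ (λ x → F (mid x)) + F bot    ∎
  where
  open ≡-Reasoning
  F′ = [ (λ x → F (mid x)) , (λ _ → F bot) ]′
  pos-suc : ∀ i → F (pos (suc i)) ≡ F′ (inner i)
  pos-suc i with inner i
  ... | inj₁ x = refl
  ... | inj₂ _ = refl

entry-∙ : ∀ {m} (t s : Triple m) P Q →
  entry t P top * entry s top Q + sumᶠ (λ x → entry t P (mid x) * entry s (mid x) Q) + entry t P bot * entry s bot Q
    ≡ entry (t ∙ s) P Q
entry-∙ t s top top     rewrite ·-zeroʳ (a t) =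
  solve 1 (λ c → con 1ℚ :* con 1ℚ :+ con 0ℚ :+ c :* con 0ℚ := con 1ℚ) refl (c t)
entry-∙ t s top (mid w) rewrite sumᶠ-δʳ w (a t) =
  solve 3 (λ x y c → con 1ℚ :* y :+ x :+ c :* con 0ℚ := x :+ y) refl (a t w) (a s w) (c t)
entry-∙ t s top bot     =
  solve 3 (λ x y d → con 1ℚ :* y :+ d :+ x :* con 1ℚ := x :+ y :+ d) refl (c t) (c s) (a t · b s)
entry-∙ t s (mid x) top rewrite ·-zeroʳ (δ x) =
  solve 1 (λ y → con 0ℚ :* con 1ℚ :+ con 0ℚ :+ y :* con 0ℚ := con 0ℚ) refl (b t x)
entry-∙ t s (mid x) (mid w) rewrite sumᶠ-δˡ x (λ y → δ y w) =
  solve 3 (λ p q r → con 0ℚ :* p :+ q :+ r :* con 0ℚ := q) refl (a s w) (δ x w) (b t x)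
entry-∙ t s (mid x) bot rewrite sumᶠ-δˡ x (b s) =
  solve 3 (λ p q r → con 0ℚ :* p :+ q :+ r :* con 1ℚ := r :+ q) refl (c s) (b s x) (b t x)
entry-∙ {m} t s bot top rewrite ·-zeroˡ {m} (λ _ → 0ℚ) = refl
entry-∙ t s bot (mid w) rewrite ·-zeroˡ (λ y → δ y w) =
  solve 1 (λ p → con 0ℚ :* p :+ con 0ℚ :+ con 1ℚ :* con 0ℚ := con 0ℚ) refl (a s w)
entry-∙ t s bot bot     rewrite ·-zeroˡ (b s) =
  solve 1 (λ p → con 0ℚ :* p :+ con 0ℚ :+ con 1ℚ :* con 1ℚ := con 1ℚ) refl (c s)

genMat-∙ : ∀ {m} (t s : Triple m) → (genMat t ⊗ genMat s) ≈M genMat (t ∙ s)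
genMat-∙ t s i j = begin
  sumᶠ (λ l → genMat t i l * genMat s l j)
    ≡⟨ sumᶠ-cong (λ l → cong₂ _*_ (genMat-entry t i l) (genMat-entry s l j)) ⟩
  sumᶠ (λ l → entry t (pos i) (pos l) * entry s (pos l) (pos j))
    ≡⟨ sumᶠ-pos (λ P → entry t (pos i) P * entry s P (pos j)) ⟩
  _ ≡⟨ entry-∙ t s (pos i) (pos j) ⟩
  entry (t ∙ s) (pos i) (pos j)
    ≡⟨ genMat-entry (t ∙ s) i j ⟨
  genMat (t ∙ s) i j ∎
  where open ≡-Reasoning

≈M-sym : ∀ {n} {A B : Mat n} → A ≈M B → B ≈M A
≈M-sym A≈B i j = sym (A≈B i j)

≈M-trans : ∀ {n} {A B C : Mat n} → A ≈M B → B ≈M C → A ≈M C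
≈M-trans A≈B B≈C i j = trans (A≈B i j) (B≈C i j)

⊗-congˡ : ∀ {n} (A : Mat n) {B B′ : Mat n} → B ≈M B′ → (A ⊗ B) ≈M (A ⊗ B′)
⊗-congˡ A B≈B′ i j = sumᶠ-cong (λ l → cong (A i l *_) (B≈B′ l j))

genMat-cong : ∀ {m} {x y : Triple m} → x ≈ y → genMat x ≈M genMat y
genMat-cong {x = x} {y} x≈y i j =
  trans (genMat-entry x i j) (trans (entry-cong x≈y (pos i) (pos j)) (sym (genMat-entry y i j)))

inner-inject₁ : ∀ {m} (x : Fin m) → inner (inject₁ x) ≡ inj₁ x
inner-inject₁ {suc m} zero    = refl
inner-inject₁ {suc m} (suc x) rewrite inner-inject₁ x = refl

inner-fromℕ : ∀ m → inner (Fin.fromℕ m) ≡ inj₂ tt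
inner-fromℕ zero    = refl
inner-fromℕ (suc m) rewrite inner-fromℕ m = refl

pos-mid : ∀ {m} (x : Fin m) → pos (suc (inject₁ x)) ≡ mid x
pos-mid x rewrite inner-inject₁ x = refl

pos-bot : ∀ m → pos {m} (suc (Fin.fromℕ m)) ≡ bot
pos-bot m rewrite inner-fromℕ m = refl

inner-inverse : ∀ {m} (i : Fin (suc m)) → [ inject₁ , (λ _ → Fin.fromℕ m) ]′ (inner i) ≡ i
inner-inverse {zero}  zero    = refl
inner-inverse {suc m} zero    = refl
inner-inverse {suc m} (suc i) with inner i | inner-inverse i
... | inj₁ _ | eq = cong suc eq
... | inj₂ _ | eq = cong suc eq

fromPos : ∀ {m} → Pos m → Fin (suc (suc m))
fromPos top     = zero
fromPos (mid x) = suc (inject₁ x)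
fromPos bot     = suc (Fin.fromℕ _)

fromPos-pos : ∀ {m} (i : Fin (suc (suc m))) → fromPos (pos i) ≡ i
fromPos-pos zero    = refl
fromPos-pos (suc i) with inner i | inner-inverse i
... | inj₁ _ | eq = cong suc eq
... | inj₂ _ | eq = cong suc eq

pos-injective : ∀ {m} {i j : Fin (suc (suc m))} → pos i ≡ pos j → i ≡ j
pos-injective {i = i} {j} eq = trans (sym (fromPos-pos i)) (trans (cong fromPos eq) (fromPos-pos j))

entry-ε-refl : ∀ {m} (P : Pos m) → entry ε P P ≡ 1ℚ
entry-ε-refl top     = refl
entry-ε-refl (mid x) = δ-refl x
entry-ε-refl bot     = refl

entry-ε-≢ : ∀ {m} {P Q : Pos m} → P ≢ Q → entry ε P Q ≡ 0ℚ
entry-ε-≢ {P = top}   {top}   P≢Q = ⊥-elim (P≢Q refl)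
entry-ε-≢ {P = top}   {mid y} P≢Q = refl
entry-ε-≢ {P = top}   {bot}   P≢Q = refl
entry-ε-≢ {P = mid x} {top}   P≢Q = refl
entry-ε-≢ {P = mid x} {mid y} P≢Q = δ-≢ (λ x≡y → P≢Q (cong mid x≡y))
entry-ε-≢ {P = mid x} {bot}   P≢Q = refl
entry-ε-≢ {P = bot}   {top}   P≢Q = refl
entry-ε-≢ {P = bot}   {mid y} P≢Q = refl
entry-ε-≢ {P = bot}   {bot}   P≢Q = ⊥-elim (P≢Q refl)

idM≈genMat-ε : ∀ {m} → idM ≈M genMat {m} ε
idM≈genMat-ε i j with i Fin.≟ j
... | yes refl = sym (trans (genMat-entry ε i i) (entry-ε-refl (pos i)))
... | no  i≢j  = sym (trans (genMat-entry ε i j) (entry-ε-≢ (λ eq → i≢j (pos-injective eq))))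

ψa-genMat : ∀ {m} (t : Triple m) y → ψa (genMat t) y ≡ a t y
ψa-genMat t y = trans (genMat-entry t zero (suc (inject₁ y))) (cong (entry t top) (pos-mid y))

ψb-genMat : ∀ {m} (t : Triple m) x → ψb (genMat t) x ≡ b t x
ψb-genMat {m} t x =
  trans (genMat-entry t (suc (inject₁ x)) (suc (Fin.fromℕ m))) (cong₂ (entry t) (pos-mid x) (pos-bot m))

-- Choosing the exponents

Balanced : ℚ → ℚ → Set
Balanced u w = ∃[ β ] ∃[ α ] ∃[ γ ] ∃[ k ]
  fromℕ (suc β) * interleavedCentre (suc k) u w
    + (fromℕ (suc α) * interleavedCentre (suc k) u (- w) + fromℕ γ * u) ≡ 0ℚ

-- With K = 2(2 + A + B) the terms 2Ku add up to K²ρw, so the whole combination is a multiple of ρ(1 + N) − (A − B).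
combination-factor : ∀ ρ w A B N K G →
  K ≡ (1ℚ + 1ℚ) * (1ℚ + 1ℚ + A + B) → G ≡ K * K * N →
  (1ℚ + B) * (K * (ρ * w) + K * (ρ * w) + K * K * w)
    + ((1ℚ + A) * (K * (ρ * w) + K * (ρ * w) + K * K * (- w)) + G * (ρ * w))
    ≡ K * K * w * (ρ * (1ℚ + N) - (A - B))
combination-factor ρ w A B N _ _ refl refl = solve 5 (λ ρ w A B N →
  let K = (con 1ℚ :+ con 1ℚ) :* (con 1ℚ :+ con 1ℚ :+ A :+ B) ; u = ρ :* w in
  (con 1ℚ :+ B) :* (K :* u :+ K :* u :+ K :* K :* w)
    :+ ((con 1ℚ :+ A) :* (K :* u :+ K :* u :+ K :* K :* (:- w)) :+ (K :* K :* N) :* u)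
  := K :* K :* w :* (ρ :* (con 1ℚ :+ N) :- (A :- B))) refl ρ w A B N

balanced-multiple : ∀ ρ w → (∃[ N ] ∃[ α ] ∃[ β ] ρ * fromℕ (suc N) ≡ fromℕ α - fromℕ β) → Balanced (ρ * w) w
balanced-multiple ρ w (N , α , β , ρ[1+N]≡α-β) = β , α , suc k ℕ.* suc k ℕ.* N , k , (begin
  _ ≡⟨ combination-factor ρ w (fromℕ α) (fromℕ β) (fromℕ N) K _ K≡ G≡ ⟩
  K * K * w * (ρ * (1ℚ + fromℕ N) - (fromℕ α - fromℕ β))
     ≡⟨ cong (λ v → K * K * w * (v - (fromℕ α - fromℕ β))) ρ[1+N]≡α-β ⟩
  K * K * w * ((fromℕ α - fromℕ β) - (fromℕ α - fromℕ β))
     ≡⟨ solve 2 (λ x y → x :* (y :- y) := con 0ℚ) refl (K * K * w) (fromℕ α - fromℕ β) ⟩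
  0ℚ ∎)
  where
  open ≡-Reasoning
  k = 3 ℕ.+ 2 ℕ.* (α ℕ.+ β)
  K = fromℕ (suc k)
  K≡ : K ≡ (1ℚ + 1ℚ) * (1ℚ + 1ℚ + fromℕ α + fromℕ β)
  K≡ = begin
    1ℚ + (1ℚ + (1ℚ + (1ℚ + fromℕ (2 ℕ.* (α ℕ.+ β)))))
      ≡⟨ cong (λ v → 1ℚ + (1ℚ + (1ℚ + (1ℚ + v)))) (trans (fromℕ-* 2 (α ℕ.+ β)) (cong (fromℕ 2 *_) (fromℕ-+ α β))) ⟩
    1ℚ + (1ℚ + (1ℚ + (1ℚ + fromℕ 2 * (fromℕ α + fromℕ β))))
      ≡⟨ solve 2 (λ A B → con 1ℚ :+ (con 1ℚ :+ (con 1ℚ :+ (con 1ℚ :+ (con 1ℚ :+ (con 1ℚ :+ con 0ℚ)) :* (A :+ B))))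
                          := (con 1ℚ :+ con 1ℚ) :* (con 1ℚ :+ con 1ℚ :+ A :+ B)) refl (fromℕ α) (fromℕ β) ⟩
    (1ℚ + 1ℚ) * (1ℚ + 1ℚ + fromℕ α + fromℕ β) ∎
  G≡ : fromℕ (suc k ℕ.* suc k ℕ.* N) ≡ K * K * fromℕ N
  G≡ = trans (fromℕ-* (suc k ℕ.* suc k) N) (cong (_* fromℕ N) (fromℕ-* (suc k) (suc k)))

balanced : ∀ u w → w ≢ 0ℚ → Balanced u w
balanced u w w≢0 = subst (λ v → Balanced v w) (sym u≡ρw) (balanced-multiple ρ w (clear-denominator ρ))
  where
  instance _ = ≢-nonZero w≢0
  ρ = u * 1/ w
  u≡ρw : u ≡ ρ * w
  u≡ρw = begin
    u               ≡⟨ *-identityʳ u ⟨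
    u * 1ℚ          ≡⟨ cong (u *_) (*-inverseˡ w) ⟨
    u * (1/ w * w)  ≡⟨ *-assoc u (1/ w) w ⟨
    ρ * w           ∎
    where open ≡-Reasoning

-- Words in the generators

infixl 8 _^ʷ_
_^ʷ_ : ∀ {A : Set} → List A → ℕ → List A
xs ^ʷ k = concat (replicate k xs)

interleave : ∀ {A : Set} → ℕ → List A → List A → List A → List A → List A
interleave k x y x′ y′ = x ^ʷ k ++ (y ^ʷ k ++ (x′ ^ʷ k ++ y′ ^ʷ k))

module Words {m r : ℕ} (g : Fin r → Triple m) where

  eval : List (Fin r) → Triple m
  eval []       = ε
  eval (i ∷ is) = g i ∙ eval is

  eval-++ : ∀ xs ys → eval (xs ++ ys) ≈ eval xs ∙ eval ys
  eval-++ []       ys = ≈-sym (∙-identityˡ (eval ys))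
  eval-++ (i ∷ xs) ys = ≈-trans (∙-congˡ (g i) (eval-++ xs ys)) (≈-sym (∙-assoc (g i) (eval xs) (eval ys)))

  eval-++-central : ∀ xs ys {s t} → eval xs ≈ central s → eval ys ≈ central t → eval (xs ++ ys) ≈ central (s + t)
  eval-++-central xs ys {s} {t} xs≈s ys≈t =
    ≈-trans (eval-++ xs ys) (≈-trans (∙-cong xs≈s ys≈t) (central-∙ s t))

  eval-^ʷ : ∀ xs k → eval (xs ^ʷ k) ≈ eval xs ^ k
  eval-^ʷ xs zero    = ≈-refl
  eval-^ʷ xs (suc k) = ≈-trans (eval-++ xs (xs ^ʷ k)) (∙-congˡ (eval xs) (eval-^ʷ xs k))

  eval-^ʷ-central : ∀ xs {u} → eval xs ≈ central u → ∀ k → eval (xs ^ʷ k) ≈ central (fromℕ k * u)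
  eval-^ʷ-central xs {u} xs≈u k = ≈-trans (eval-^ʷ xs k) (≈-trans (^-cong xs≈u k) (central-^ u k))

  eval-rotate : ∀ xs ys {u} → eval (xs ++ ys) ≈ central u → eval (ys ++ xs) ≈ central u
  eval-rotate xs ys {u} xsys≈u = ≈-trans (eval-++ ys xs)
    (∙-rotate-central (eval xs) (eval ys) u (≈-trans (≈-sym (eval-++ xs ys)) xsys≈u))

  rotation-starting-at : ∀ L {u} → eval L ≈ central u → ∀ j → ∃[ U ] eval (lookup L j ∷ U) ≈ central u
  rotation-starting-at L {u} L≈u j with ∈-∃++ (∈-lookup {xs = L} j)
  ... | xs , ys , L≡xs++j∷ys =
    ys ++ xs , eval-rotate xs (lookup L j ∷ ys) (subst (λ l → eval l ≈ central u) L≡xs++j∷ys L≈u)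

  prodL-eval : ∀ is → prodL (map (λ j → genMat (g j)) is) ≈M genMat (eval is)
  prodL-eval []       = idM≈genMat-ε
  prodL-eval (i ∷ is) = ≈M-trans (⊗-congˡ (genMat (g i)) (prodL-eval is)) (genMat-∙ (g i) (eval is))

  prodW-eval : ∀ w → prodW g w ≈M genMat (eval (toList w))
  prodW-eval (i ∷ is) = prodL-eval (i ∷ is)

  eval-central : ∀ w → (∀ x → ψa (prodW g w) x ≡ 0ℚ) → (∀ x → ψb (prodW g w) x ≡ 0ℚ) →
    eval (toList w) ≈ central (c (eval (toList w)))
  eval-central w ψa≡0 ψb≡0 =
    (λ x → trans (sym (ψa-genMat (eval L) x)) (trans (sym (prodW-eval w zero (suc (inject₁ x)))) (ψa≡0 x))) ,
    (λ x → trans (sym (ψb-genMat (eval L) x)) (trans (sym (prodW-eval w (suc (inject₁ x)) (Fin.fromℕ (suc m)))) (ψb≡0 x))) ,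
    refl
    where L = toList w

  idM∈S : ∀ is → is ≢ [] → eval is ≈ ε → idM ∈S g
  idM∈S []       is≢[] _    = ⊥-elim (is≢[] refl)
  idM∈S (i ∷ is) _     is≈ε =
    i ∷ is , ≈M-trans (prodW-eval (i ∷ is)) (≈M-trans (genMat-cong is≈ε) (≈M-sym idM≈genMat-ε))

  eval-interleave : ∀ x y x′ y′ {u} → eval (x ++ x′) ≈ central u → eval (y ++ y′) ≈ central u → ∀ k →
    eval (interleave k x y x′ y′) ≈ central (interleavedCentre k u (ω (eval x) (eval y)))
  eval-interleave x y x′ y′ {u} xx′≈u yy′≈u k = ≈-trans powers
    (interleaved-^ (eval x) (eval y) (eval x′) (eval y′) u
      (≈-trans (≈-sym (eval-++ x x′)) xx′≈u) (≈-trans (≈-sym (eval-++ y y′)) yy′≈u) k)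
    where
    powers : eval (interleave k x y x′ y′) ≈ eval x ^ k ∙ (eval y ^ k ∙ (eval x′ ^ k ∙ eval y′ ^ k))
    powers =
      ≈-trans (eval-++ (x ^ʷ k) _) (∙-cong (eval-^ʷ x k)
      (≈-trans (eval-++ (y ^ʷ k) _) (∙-cong (eval-^ʷ y k)
      (≈-trans (eval-++ (x′ ^ʷ k) _) (∙-cong (eval-^ʷ x′ k) (eval-^ʷ y′ k))))))

  idM∈S-of-balanced : ∀ L p q {u} → eval L ≈ central u →
    (∃[ U ] eval (p ∷ U) ≈ central u) → (∃[ V ] eval (q ∷ V) ≈ central u) →
    Balanced u (ω (g p) (g q)) → idM ∈S g
  idM∈S-of-balanced L p q {u} L≈u (U , pU≈u) (V , qV≈u) (β , α , γ , k , total≡0) =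
    idM∈S word (λ ()) (≈-trans eval-word (central-cong total≡0))
    where
    κ = ω (g p) (g q)
    X  = interleave (suc k) (p ∷ []) (q ∷ []) U V
    X′ = interleave (suc k) (q ∷ []) (p ∷ []) V U
    word = X ^ʷ suc β ++ (X′ ^ʷ suc α ++ L ^ʷ γ)
    ω-letters : ω (eval (p ∷ [])) (eval (q ∷ [])) ≡ κ
    ω-letters = ω-cong (∙-identityʳ (g p)) (∙-identityʳ (g q))
    eval-X : eval X ≈ central (interleavedCentre (suc k) u κ)
    eval-X = ≈-trans (eval-interleave (p ∷ []) (q ∷ []) U V pU≈u qV≈u (suc k))
      (central-cong (cong (interleavedCentre (suc k) u) ω-letters))
    eval-X′ : eval X′ ≈ central (interleavedCentre (suc k) u (- κ))
    eval-X′ = ≈-trans (eval-interleave (q ∷ []) (p ∷ []) V U qV≈u pU≈u (suc k))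
      (central-cong (cong (interleavedCentre (suc k) u)
        (trans (ω-antisym (eval (p ∷ [])) (eval (q ∷ []))) (cong -_ ω-letters))))
    eval-word : eval word ≈ central (fromℕ (suc β) * interleavedCentre (suc k) u κ
                  + (fromℕ (suc α) * interleavedCentre (suc k) u (- κ) + fromℕ γ * u))
    eval-word =
      eval-++-central (X ^ʷ suc β) (X′ ^ʷ suc α ++ L ^ʷ γ) (eval-^ʷ-central X eval-X (suc β))
        (eval-++-central (X′ ^ʷ suc α) (L ^ʷ γ) (eval-^ʷ-central X′ eval-X′ (suc α)) (eval-^ʷ-central L L≈u γ))

lemma17 : (m : ℕ) → 1 ≤ m → (r : ℕ) → (g : Fin r → Triple m) →
    (Σ (List⁺ (Fin r)) λ w →
      ((∀ x → ψa (prodW g w) x ≡ 0ℚ) × (∀ x → ψb (prodW g w) x ≡ 0ℚ)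
        × (∃[ c ] ψc (prodW g w) ≡ c))
      × (∃[ j₁ ] ∃[ j₂ ]
          (Triple.a (g (letter w j₁)) · Triple.b (g (letter w j₂))
            ≢ Triple.a (g (letter w j₂)) · Triple.b (g (letter w j₁))))) →
    idM ∈S g
lemma17 m _ r g (w , (ψa≡0 , ψb≡0 , _) , (j₁ , j₂ , cross≢)) =
  idM∈S-of-balanced L p q L≈central
    (rotation-starting-at L L≈central j₁) (rotation-starting-at L L≈central j₂) (balanced _ _ ω≢0)
  where
  open Words g
  L = toList w
  p = letter w j₁
  q = letter w j₂
  L≈central : eval L ≈ central (c (eval L))
  L≈central = eval-central w ψa≡0 ψb≡0
  ω≢0 : ω (g p) (g q) ≢ 0ℚ
  ω≢0 ω≡0 = cross≢ (x∙y⁻¹≈ε⇒x≈y (a (g p) · b (g q)) (a (g q) · b (g p)) ω≡0)
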